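{- There is no integer $c\ge3$, $c\ne 239^2-1$, such that each of $(2,239^2-1,c)$, $(3,239^2,c+1)$ and $(4,239^2+1,c+2)$ is multiplicatively dependent.
   Context: A tuple $(z_1,\dots,z_n)$ of positive integers is multiplicatively dependent if there exists a nonzero $(k_1,\dots,k_n)\in\mathbb{Z}^n$ with $z_1^{k_1}\cdots z_n^{k_n}=1$. -}

module Defs where

open import Data.Nat using (ℕ; zero; suc; _*_; _^_; _≤_; _∸_; _+_)
open import Data.Integer using (ℤ; +_; -[1+_])
open import Data.Vec using (Vec; []; _∷_)
open import Data.Product using (Σ; _×_)
open import Relation.Binary.PropositionalEquality using (_≡_)
open import Relation.Nullary using (¬_)

-- z ^ k for k ∈ ℤ, split into numerator and denominator:
-- z ^ (+ n) = z^n / 1,   z ^ -[1+ n ] = 1 / z^(suc n).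
num : ℕ → ℤ → ℕ
num z (+ n)    = z ^ n
num z -[1+ n ] = 1

den : ℕ → ℤ → ℕ
den z (+ n)    = 1
den z -[1+ n ] = z ^ suc n

prodNum : ∀ {n} → Vec ℕ n → Vec ℤ n → ℕ
prodNum []       []       = 1
prodNum (z ∷ zs) (k ∷ ks) = num z k * prodNum zs ks

prodDen : ∀ {n} → Vec ℕ n → Vec ℤ n → ℕ
prodDen []       []       = 1
prodDen (z ∷ zs) (k ∷ ks) = den z k * prodDen zs ks

NonZeroVec : ∀ {n} → Vec ℤ n → Set
NonZeroVec {n} ks = ¬ (ks ≡ Data.Vec.replicate n (+ 0))

-- (z₁,…,zₙ) multiplicatively dependent: ∃ nonzero k ∈ ℤⁿ with z₁^k₁ ⋯ zₙ^kₙ = 1,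
-- i.e. the numerator equals the denominator.
MultDep : ∀ {n} → Vec ℕ n → Set
MultDep {n} zs = Σ (Vec ℤ n) λ ks → NonZeroVec ks × (prodNum zs ks ≡ prodDen zs ks)

-- In a relation z₁^k₁ ⋯ zₙ^kₙ = 1, written as num = den, a prime dividing some zᵢ with kᵢ ≠ 0
-- divides one side, hence also some zⱼ with kⱼ of the opposite sign. Applied to the three triples
-- this confines the prime factors of c to those of 2·(239² − 1), of c + 1 to {3, 239} and of
-- c + 2 to {2, 13}; moreover c is a power of 2 unless 3 ∣ c, since 3 ∣ 239² − 1.
-- In every case 4 ∣ c: either c = 2^x ≥ 3, or 3 ∣ c and c + 1 = 239^v with v even.
-- Hence c + 2 ≡ 2 (mod 4) forces c + 2 = 2·13^t, so c ≡ 2·13^t − 2 ≡ 0 (mod 3), which rules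
-- out the power-of-2 case. If t ≤ 4 then 239^v = c + 1 ≤ 239² gives c = 239² − 1; if t ≥ 5 then
-- 239^v ≡ −1 (mod 13⁵) makes the prime 23167 divide c, although it does not divide 2·(239² − 1).

module Submission where

open import Defs
open import Data.Nat using (ℕ; zero; suc; _+_; _*_; _∸_; _^_; _≤_; _<_; _%_; _/_; NonZero; ≢-nonZero; z≤n; s≤s; _≤?_)
open import Data.Nat.Properties
  using (_≟_; +-comm; +-assoc; +-suc; *-assoc; *-identityˡ; *-identityʳ; +-cancelˡ-≡; +-cancelʳ-≡; +-cancelʳ-≤; ≤-antisym; ≰⇒>;
         m+[n∸m]≡n; m+1+n≢0; m<n⇒n≢0; ^-distribˡ-+-*; ^-monoʳ-≤; *-monoʳ-≤; allUpTo?; *-commutativeSemigroup)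
open import Data.Nat.DivMod using (%-distribˡ-*; m%n%n≡m%n; m≡m%n+[m/n]*n; m%n<n; n%1≡0; %-remove-+ˡ; %-pred-≡0)
open import Data.Nat.Divisibility
  using (_∣_; _∤_; divides; _∣?_; ∣1⇒≡1; ∣-refl; ∣-trans; m∣m*n; n∣m*n; ∣m+n∣m⇒∣n; ∣m∣n⇒∣m+n; n∣m⇒m%n≡0)
open import Data.Nat.Primality using (Prime; ¬prime[1]; prime[2]; prime?; euclidsLemma; prime⇒irreducible)
open import Data.Nat.Primality.Factorisation using (factorise)
open import Data.Nat.ListAction using (product)
open import Data.Nat.ListAction.Properties using (∈⇒∣product)
open import Data.Integer using (ℤ; +_; +[1+_]; -[1+_]; -_; 0ℤ; +<+) renaming (_<_ to _<ℤ_; _≟_ to _≟ℤ_)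
open import Data.Integer.Properties using (neg-mono-<; neg-cancel-<; <-asym; <⇒≢; <-cmp)
open import Data.Fin using (zero; suc)
open import Data.Vec using (Vec; []; _∷_; lookup; map)
open import Data.Vec.Properties using (lookup-map)
open import Data.List using ([]; _∷_)
open import Data.List.Relation.Unary.All using (All; []; _∷_; tabulate)
import Data.List.Relation.Unary.All as All
open import Data.Product using (∃-syntax; _×_; _,_; proj₁; proj₂)
open import Data.Sum using (_⊎_; inj₁; inj₂; [_,_])
import Data.Sum as Sum
open import Function using (_∘_; _∘₂_)
open import Relation.Binary using (tri<; tri≈; tri>)
open import Relation.Binary.PropositionalEquality using (_≡_; _≢_; refl; sym; trans; cong; cong₂; subst; module ≡-Reasoning)
open import Relation.Nullary using (¬_; yes; no; contradiction)
open import Relation.Nullary.Decidable using (from-yes; from-no; _→-dec_; decidable-stable)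
import Algebra.Properties.CommutativeSemigroup as CommutativeSemigroupProperties
open CommutativeSemigroupProperties *-commutativeSemigroup using () renaming (x∙yz≈y∙xz to m*[n*o]≡n*[m*o])

open ≡-Reasoning

prime∤1 : ∀ {p} → Prime p → p ∤ 1
prime∤1 p-prime p∣1 = ¬prime[1] (subst Prime (∣1⇒≡1 p∣1) p-prime)

prime∣prime⇒≡ : ∀ {p q} → Prime p → Prime q → p ∣ q → p ≡ q
prime∣prime⇒≡ p-prime q-prime p∣q with prime⇒irreducible q-prime p∣q
... | inj₁ refl = contradiction p-prime ¬prime[1]
... | inj₂ p≡q  = p≡q

prime∣^⇒∣ : ∀ {p m} n → Prime p → p ∣ m ^ n → p ∣ m
prime∣^⇒∣ zero    p-prime p∣1 = contradiction p∣1 (prime∤1 p-prime)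
prime∣^⇒∣ {m = m} (suc n) p-prime p∣m^1+n with euclidsLemma m (m ^ n) p-prime p∣m^1+n
... | inj₁ p∣m   = p∣m
... | inj₂ p∣m^n = prime∣^⇒∣ n p-prime p∣m^n

prime∣prime^⇒≡ : ∀ {p q} n → Prime p → Prime q → p ∣ q ^ n → p ≡ q
prime∣prime^⇒≡ n p-prime q-prime p∣q^n = prime∣prime⇒≡ p-prime q-prime (prime∣^⇒∣ n p-prime p∣q^n)

^-monoʳ-∣ : ∀ a {m n} → m ≤ n → a ^ m ∣ a ^ n
^-monoʳ-∣ a {m} {n} m≤n = subst (a ^ m ∣_) a^m*a^[n∸m]≡a^n (m∣m*n (a ^ (n ∸ m)))
  where
  a^m*a^[n∸m]≡a^n : a ^ m * a ^ (n ∸ m) ≡ a ^ n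
  a^m*a^[n∸m]≡a^n = trans (sym (^-distribˡ-+-* a m (n ∸ m))) (cong (a ^_) (m+[n∸m]≡n m≤n))

IsRelation : ∀ {n} → Vec ℕ n → Vec ℤ n → Set
IsRelation zs ks = prodNum zs ks ≡ prodDen zs ks

prime∣num⇒∣∧pos : ∀ {p} z k → Prime p → p ∣ num z k → p ∣ z × 0ℤ <ℤ k
prime∣num⇒∣∧pos z (+ zero) p-prime p∣1   = contradiction p∣1 (prime∤1 p-prime)
prime∣num⇒∣∧pos z +[1+ n ] p-prime p∣z^k = prime∣^⇒∣ (suc n) p-prime p∣z^k , +<+ (s≤s z≤n)
prime∣num⇒∣∧pos z -[1+ n ] p-prime p∣1   = contradiction p∣1 (prime∤1 p-prime)

∣∧pos⇒∣num : ∀ {p} z k → p ∣ z → 0ℤ <ℤ k → p ∣ num z k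
∣∧pos⇒∣num z (+ zero) _   (+<+ ())
∣∧pos⇒∣num z +[1+ n ] p∣z _ = ∣-trans p∣z (m∣m*n (z ^ n))

prime∣prodNum⇒∃∣∧pos : ∀ {n p} (zs : Vec ℕ n) ks → Prime p → p ∣ prodNum zs ks →
                 ∃[ i ] p ∣ lookup zs i × 0ℤ <ℤ lookup ks i
prime∣prodNum⇒∃∣∧pos []       []       p-prime p∣1 = contradiction p∣1 (prime∤1 p-prime)
prime∣prodNum⇒∃∣∧pos (z ∷ zs) (k ∷ ks) p-prime p∣prod with euclidsLemma (num z k) (prodNum zs ks) p-prime p∣prod
... | inj₁ p∣num  = zero , prime∣num⇒∣∧pos z k p-prime p∣num
... | inj₂ p∣rest = let i , p∣zᵢ∧0<kᵢ = prime∣prodNum⇒∃∣∧pos zs ks p-prime p∣rest in suc i , p∣zᵢ∧0<kᵢ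

∣∧pos⇒∣prodNum : ∀ {n p} (zs : Vec ℕ n) ks i → p ∣ lookup zs i → 0ℤ <ℤ lookup ks i → p ∣ prodNum zs ks
∣∧pos⇒∣prodNum (z ∷ zs) (k ∷ ks) zero    p∣z 0<k = ∣-trans (∣∧pos⇒∣num z k p∣z 0<k) (m∣m*n (prodNum zs ks))
∣∧pos⇒∣prodNum (z ∷ zs) (k ∷ ks) (suc i) p∣z 0<k = ∣-trans (∣∧pos⇒∣prodNum zs ks i p∣z 0<k) (n∣m*n (num z k))

den≡num-neg : ∀ z k → den z k ≡ num z (- k)
den≡num-neg z (+ zero) = refl
den≡num-neg z +[1+ n ] = refl
den≡num-neg z -[1+ n ] = refl

prodDen≡prodNum-neg : ∀ {n} (zs : Vec ℕ n) ks → prodDen zs ks ≡ prodNum zs (map -_ ks)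
prodDen≡prodNum-neg []       []       = refl
prodDen≡prodNum-neg (z ∷ zs) (k ∷ ks) = cong₂ _*_ (den≡num-neg z k) (prodDen≡prodNum-neg zs ks)

prime∣prodDen⇒∃∣∧neg : ∀ {n p} (zs : Vec ℕ n) ks → Prime p → p ∣ prodDen zs ks →
                 ∃[ i ] p ∣ lookup zs i × lookup ks i <ℤ 0ℤ
prime∣prodDen⇒∃∣∧neg zs ks p-prime p∣prod
  with prime∣prodNum⇒∃∣∧pos zs (map -_ ks) p-prime (subst (_ ∣_) (prodDen≡prodNum-neg zs ks) p∣prod)
... | i , p∣zᵢ , 0<-kᵢ = i , p∣zᵢ , neg-cancel-< (subst (0ℤ <ℤ_) (lookup-map i -_ ks) 0<-kᵢ)

∣∧neg⇒∣prodDen : ∀ {n p} (zs : Vec ℕ n) ks i → p ∣ lookup zs i → lookup ks i <ℤ 0ℤ → p ∣ prodDen zs ks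
∣∧neg⇒∣prodDen zs ks i p∣zᵢ kᵢ<0 = subst (_ ∣_) (sym (prodDen≡prodNum-neg zs ks))
  (∣∧pos⇒∣prodNum zs (map -_ ks) i p∣zᵢ (subst (0ℤ <ℤ_) (sym (lookup-map i -_ ks)) (neg-mono-< kᵢ<0)))

relation⇒prime-shared : ∀ {n p} (zs : Vec ℕ n) ks → IsRelation zs ks → Prime p → ∀ i →
  p ∣ lookup zs i → lookup ks i ≢ 0ℤ → ∃[ j ] j ≢ i × p ∣ lookup zs j × lookup ks j ≢ 0ℤ
relation⇒prime-shared zs ks rel p-prime i p∣zᵢ kᵢ≢0 with <-cmp (lookup ks i) 0ℤ
... | tri≈ _ kᵢ≡0 _ = contradiction kᵢ≡0 kᵢ≢0
... | tri< kᵢ<0 _ _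
  with prime∣prodNum⇒∃∣∧pos zs ks p-prime (subst (_ ∣_) (sym rel) (∣∧neg⇒∣prodDen zs ks i p∣zᵢ kᵢ<0))
...   | j , p∣zⱼ , 0<kⱼ = j , (λ { refl → <-asym kᵢ<0 0<kⱼ }) , p∣zⱼ , <⇒≢ 0<kⱼ ∘ sym
relation⇒prime-shared zs ks rel p-prime i p∣zᵢ kᵢ≢0 | tri> _ _ 0<kᵢ
  with prime∣prodDen⇒∃∣∧neg zs ks p-prime (subst (_ ∣_) rel (∣∧pos⇒∣prodNum zs ks i p∣zᵢ 0<kᵢ))
...   | j , p∣zⱼ , kⱼ<0 = j , (λ { refl → <-asym kⱼ<0 0<kᵢ }) , p∣zⱼ , <⇒≢ kⱼ<0

module _ {A B z r s : ℕ} (r-prime : Prime r) (r∣A : r ∣ A) (s-prime : Prime s) (s∣B : s ∣ B) (s∤A : s ∤ A) where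

  module _ (k₁ k₂ k₃ : ℤ) (rel : IsRelation (A ∷ B ∷ z ∷ []) (k₁ ∷ k₂ ∷ k₃ ∷ [])) where

    private
      zs : Vec ℕ 3
      zs = A ∷ B ∷ z ∷ []

      ks : Vec ℤ 3
      ks = k₁ ∷ k₂ ∷ k₃ ∷ []

    k₂≢0⇒s∣z∧k₃≢0 : k₂ ≢ 0ℤ → s ∣ z × k₃ ≢ 0ℤ
    k₂≢0⇒s∣z∧k₃≢0 k₂≢0 with relation⇒prime-shared zs ks rel s-prime (suc zero) s∣B k₂≢0
    ... | zero           , _   , s∣A , _    = contradiction s∣A s∤A
    ... | suc zero       , 1≢1 , _          = contradiction refl 1≢1
    ... | suc (suc zero) , _   , s∣z , k₃≢0 = s∣z , k₃≢0

    k₃≡0⇒k₂≡0 : k₃ ≡ 0ℤ → k₂ ≡ 0ℤ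
    k₃≡0⇒k₂≡0 k₃≡0 with k₂ ≟ℤ 0ℤ
    ... | yes k₂≡0 = k₂≡0
    ... | no  k₂≢0 = contradiction k₃≡0 (proj₂ (k₂≢0⇒s∣z∧k₃≢0 k₂≢0))

    k₂≡0∧k₃≡0⇒k₁≡0 : k₂ ≡ 0ℤ → k₃ ≡ 0ℤ → k₁ ≡ 0ℤ
    k₂≡0∧k₃≡0⇒k₁≡0 k₂≡0 k₃≡0 with k₁ ≟ℤ 0ℤ
    ... | yes k₁≡0 = k₁≡0
    ... | no  k₁≢0 with relation⇒prime-shared zs ks rel r-prime zero r∣A k₁≢0
    ...   | zero           , 0≢0 , _        = contradiction refl 0≢0
    ...   | suc zero       , _   , _ , k₂≢0 = contradiction k₂≡0 k₂≢0
    ...   | suc (suc zero) , _   , _ , k₃≢0 = contradiction k₃≡0 k₃≢0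

    k₃≢0 : NonZeroVec ks → k₃ ≢ 0ℤ
    k₃≢0 nonzero k₃≡0 = nonzero (cong₂ _∷_ (k₂≡0∧k₃≡0⇒k₁≡0 k₂≡0 k₃≡0) (cong₂ _∷_ k₂≡0 (cong (_∷ []) k₃≡0)))
      where
      k₂≡0 : k₂ ≡ 0ℤ
      k₂≡0 = k₃≡0⇒k₂≡0 k₃≡0

    prime∣z⇒∣A⊎∣B∧k₂≢0 : NonZeroVec ks → ∀ {p} → Prime p → p ∣ z → p ∣ A ⊎ (p ∣ B × k₂ ≢ 0ℤ)
    prime∣z⇒∣A⊎∣B∧k₂≢0 nonzero p-prime p∣z
      with relation⇒prime-shared zs ks rel p-prime (suc (suc zero)) p∣z (k₃≢0 nonzero)
    ... | zero           , _   , p∣A , _    = inj₁ p∣A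
    ... | suc zero       , _   , p∣B , k₂≢0 = inj₂ (p∣B , k₂≢0)
    ... | suc (suc zero) , 2≢2 , _          = contradiction refl 2≢2

  prime∣z⇒∣A⊎∣B : MultDep (A ∷ B ∷ z ∷ []) → ∀ {p} → Prime p → p ∣ z → p ∣ A ⊎ p ∣ B
  prime∣z⇒∣A⊎∣B (k₁ ∷ k₂ ∷ k₃ ∷ [] , nonzero , rel) p-prime p∣z =
    Sum.map₂ proj₁ (prime∣z⇒∣A⊎∣B∧k₂≢0 k₁ k₂ k₃ rel nonzero p-prime p∣z)

  s∤z⇒prime∣z⇒∣A : MultDep (A ∷ B ∷ z ∷ []) → s ∤ z → ∀ {p} → Prime p → p ∣ z → p ∣ A
  s∤z⇒prime∣z⇒∣A (k₁ ∷ k₂ ∷ k₃ ∷ [] , nonzero , rel) s∤z p-prime p∣z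
    with prime∣z⇒∣A⊎∣B∧k₂≢0 k₁ k₂ k₃ rel nonzero p-prime p∣z
  ... | inj₁ p∣A        = p∣A
  ... | inj₂ (_ , k₂≢0) = contradiction (proj₁ (k₂≢0⇒s∣z∧k₃≢0 k₁ k₂ k₃ rel k₂≢0)) s∤z

product≡^*^ : ∀ {a b} ns → All (λ n → n ≡ a ⊎ n ≡ b) ns → ∃[ i ] ∃[ j ] product ns ≡ a ^ i * b ^ j
product≡^*^         []       []            = 0 , 0 , refl
product≡^*^ {a} {b} (n ∷ ns) (n≡a⊎b ∷ ns≡a⊎b) with product≡^*^ ns ns≡a⊎b | n≡a⊎b
... | i , j , ∏ns≡ | inj₁ refl = suc i , j , (begin
  a * product ns      ≡⟨ cong (a *_) ∏ns≡ ⟩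
  a * (a ^ i * b ^ j) ≡⟨ *-assoc a (a ^ i) (b ^ j) ⟨
  a ^ suc i * b ^ j   ∎)
... | i , j , ∏ns≡ | inj₂ refl = i , suc j , (begin
  b * product ns      ≡⟨ cong (b *_) ∏ns≡ ⟩
  b * (a ^ i * b ^ j) ≡⟨ m*[n*o]≡n*[m*o] b (a ^ i) (b ^ j) ⟩
  a ^ i * b ^ suc j   ∎)

prime-factors⇒≡^*^ : ∀ n .{{_ : NonZero n}} {a b} → (∀ {p} → Prime p → p ∣ n → p ≡ a ⊎ p ≡ b) →
                     ∃[ i ] ∃[ j ] n ≡ a ^ i * b ^ j
prime-factors⇒≡^*^ n p∣n⇒p≡a⊎b with factorise n
... | record { factors = ps ; isFactorisation = n≡∏ps ; factorsPrime = ps-prime }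
  with product≡^*^ ps (tabulate λ p∈ps →
         p∣n⇒p≡a⊎b (All.lookup ps-prime p∈ps) (subst (_ ∣_) (sym n≡∏ps) (∈⇒∣product p∈ps)))
... | i , j , ∏ps≡ = i , j , trans n≡∏ps ∏ps≡

prime-factors⇒≡^ : ∀ n .{{_ : NonZero n}} {a} → (∀ {p} → Prime p → p ∣ n → p ≡ a) → ∃[ i ] n ≡ a ^ i
prime-factors⇒≡^ n {a} p∣n⇒p≡a with prime-factors⇒≡^*^ n {a} {a} (inj₁ ∘₂ p∣n⇒p≡a)
... | i , j , n≡ = i + j , trans n≡ (sym (^-distribˡ-+-* a i j))

*-%-unitʳ : ∀ m n d .{{_ : NonZero d}} → n % d ≡ 1 → (m * n) % d ≡ m % d
*-%-unitʳ m n d n%d≡1 = begin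
  (m * n) % d           ≡⟨ %-distribˡ-* m n d ⟩
  (m % d * (n % d)) % d ≡⟨ cong (λ x → (m % d * x) % d) n%d≡1 ⟩
  (m % d * 1) % d       ≡⟨ cong (_% d) (*-identityʳ (m % d)) ⟩
  m % d % d             ≡⟨ m%n%n≡m%n m d ⟩
  m % d                 ∎

^-%-periodic : ∀ a p {d} .{{_ : NonZero p}} .{{_ : NonZero d}} → a ^ p % d ≡ 1 →
               ∀ v → a ^ v % d ≡ a ^ (v % p) % d
^-%-periodic a p {d} a^p%d≡1 v = begin
  a ^ v % d                 ≡⟨ cong (λ e → a ^ e % d) (trans (m≡m%n+[m/n]*n v p) (+-comm (v % p) _)) ⟩
  a ^ (v / p * p + v % p) % d ≡⟨ shift (v / p) (v % p) ⟩
  a ^ (v % p) % d           ∎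
  where
  shift : ∀ k r → a ^ (k * p + r) % d ≡ a ^ r % d
  shift zero    r = refl
  shift (suc k) r = begin
    a ^ ((p + k * p) + r) % d     ≡⟨ cong (λ e → a ^ e % d) (trans (+-assoc p (k * p) r) (+-comm p _)) ⟩
    a ^ ((k * p + r) + p) % d     ≡⟨ cong (_% d) (^-distribˡ-+-* a (k * p + r) p) ⟩
    (a ^ (k * p + r) * a ^ p) % d ≡⟨ *-%-unitʳ (a ^ (k * p + r)) (a ^ p) d a^p%d≡1 ⟩
    a ^ (k * p + r) % d           ≡⟨ shift k r ⟩
    a ^ r % d                     ∎

^-%-periodic-implication : ∀ a p {d e x y} .{{_ : NonZero p}} .{{_ : NonZero d}} .{{_ : NonZero e}} →
  a ^ p % d ≡ 1 → a ^ p % e ≡ 1 → (∀ {r} → r < p → a ^ r % d ≡ x → a ^ r % e ≡ y) →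
  ∀ v → a ^ v % d ≡ x → a ^ v % e ≡ y
^-%-periodic-implication a p {d} {e} {x} {y} a^p%d≡1 a^p%e≡1 table v a^v%d≡x = begin
  a ^ v % e       ≡⟨ ^-%-periodic a p a^p%e≡1 v ⟩
  a ^ (v % p) % e ≡⟨ table (m%n<n v p) (trans (sym (^-%-periodic a p a^p%d≡1 v)) a^v%d≡x) ⟩
  y               ∎

[m+n]%d≡n%d⇒d∣m : ∀ m n {d} .{{_ : NonZero d}} → (m + n) % d ≡ n % d → d ∣ m
[m+n]%d≡n%d⇒d∣m m n {d} [m+n]%d≡n%d = ∣m+n∣m⇒∣n (divides ((m + n) / d) q₂d+m≡q₁d) (divides (n / d) refl)
  where
  q₂d+m≡q₁d : n / d * d + m ≡ (m + n) / d * d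
  q₂d+m≡q₁d = +-cancelˡ-≡ (n % d) _ _ (begin
    n % d + (n / d * d + m)       ≡⟨ +-assoc (n % d) _ m ⟨
    n % d + n / d * d + m         ≡⟨ cong (_+ m) (m≡m%n+[m/n]*n n d) ⟨
    n + m                         ≡⟨ +-comm n m ⟩
    m + n                         ≡⟨ m≡m%n+[m/n]*n (m + n) d ⟩
    (m + n) % d + (m + n) / d * d ≡⟨ cong (_+ (m + n) / d * d) [m+n]%d≡n%d ⟩
    n % d + (m + n) / d * d       ∎)

3≤2^n⇒4∣2^n : ∀ n → 3 ≤ 2 ^ n → 4 ∣ 2 ^ n
3≤2^n⇒4∣2^n zero          (s≤s ())
3≤2^n⇒4∣2^n (suc zero)    (s≤s (s≤s ()))
3≤2^n⇒4∣2^n (suc (suc n)) _ = ^-monoʳ-∣ 2 {2} {2 + n} (s≤s (s≤s z≤n))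

4∣n⇒n+2≡2^s*m⇒s≡1 : ∀ {n m} s → 4 ∣ n → 2 ∤ m → n + 2 ≡ 2 ^ s * m → s ≡ 1
4∣n⇒n+2≡2^s*m⇒s≡1 {n} {m} zero 4∣n 2∤m n+2≡m =
  contradiction (subst (2 ∣_) (trans n+2≡m (*-identityˡ m)) (∣m∣n⇒∣m+n (∣-trans (divides 2 refl) 4∣n) ∣-refl)) 2∤m
4∣n⇒n+2≡2^s*m⇒s≡1 (suc zero) _ _ _ = refl
4∣n⇒n+2≡2^s*m⇒s≡1 {n} {m} (suc (suc s)) 4∣n _ n+2≡ =
  contradiction (∣m+n∣m⇒∣n (subst (4 ∣_) (sym n+2≡) 4∣2^[2+s]*m) 4∣n) (from-no (4 ∣? 2))
  where
  4∣2^[2+s]*m : 4 ∣ 2 ^ suc (suc s) * m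
  4∣2^[2+s]*m = ∣-trans (^-monoʳ-∣ 2 {2} {2 + s} (s≤s (s≤s z≤n))) (m∣m*n m)

3-prime : Prime 3
3-prime = from-yes (prime? 3)

13-prime : Prime 13
13-prime = from-yes (prime? 13)

239-prime : Prime 239
239-prime = from-yes (prime? 239)

23167-prime : Prime 23167
23167-prime = from-yes (prime? 23167)

239^v%3≡1⇒239^v%4≡1 : ∀ v → 239 ^ v % 3 ≡ 1 → 239 ^ v % 4 ≡ 1
239^v%3≡1⇒239^v%4≡1 = ^-%-periodic-implication 239 2 refl refl
  (from-yes (allUpTo? (λ r → (239 ^ r % 3 ≟ 1) →-dec (239 ^ r % 4 ≟ 1)) 2))

-- 239 has order 52 modulo 13⁵, so 239 ^ v ≡ -1 forces v ≡ 26 (mod 52); and 23167 ∣ 239 ^ 26 - 1.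
239^v%13⁵≡-1⇒239^v%23167≡1 : ∀ v → 239 ^ v % 13 ^ 5 ≡ 13 ^ 5 ∸ 1 → 239 ^ v % 23167 ≡ 1
239^v%13⁵≡-1⇒239^v%23167≡1 = ^-%-periodic-implication 239 52 refl refl
  (from-yes (allUpTo? (λ r → (239 ^ r % 13 ^ 5 ≟ 13 ^ 5 ∸ 1) →-dec (239 ^ r % 23167 ≟ 1)) 52))

2∤13^ : ∀ t → 2 ∤ 13 ^ t
2∤13^ t 2∣13^t = from-no (2 ∣? 13) (prime∣^⇒∣ t prime[2] 2∣13^t)

4∣c∧c+2-smooth⇒c+2≡2*13^t : ∀ {c} → 4 ∣ c → ∃[ s ] ∃[ t ] c + 2 ≡ 2 ^ s * 13 ^ t → ∃[ t ] c + 2 ≡ 2 * 13 ^ t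
4∣c∧c+2-smooth⇒c+2≡2*13^t {c} 4∣c (s , t , c+2≡2^s*13^t) =
  t , subst (λ s → c + 2 ≡ 2 ^ s * 13 ^ t) (4∣n⇒n+2≡2^s*m⇒s≡1 s 4∣c (2∤13^ t) c+2≡2^s*13^t) c+2≡2^s*13^t

c+2≡2*13^t⇒3∣c : ∀ {c} → ∃[ t ] c + 2 ≡ 2 * 13 ^ t → 3 ∣ c
c+2≡2*13^t⇒3∣c {c} (t , c+2≡2*13^t) = [m+n]%d≡n%d⇒d∣m c 2 (begin
  (c + 2) % 3      ≡⟨ cong (_% 3) c+2≡2*13^t ⟩
  (2 * 13 ^ t) % 3 ≡⟨ *-%-unitʳ 2 (13 ^ t) 3 13^t%3≡1 ⟩
  2 % 3            ∎)
  where
  13^t%3≡1 : 13 ^ t % 3 ≡ 1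
  13^t%3≡1 = trans (^-%-periodic 13 1 refl t) (cong (λ e → 13 ^ e % 3) (n%1≡0 t))

3∣c∧c+1≡239^v⇒4∣c : ∀ {c} → 3 ∣ c → ∃[ v ] c + 1 ≡ 239 ^ v → 4 ∣ c
3∣c∧c+1≡239^v⇒4∣c {c} 3∣c (v , c+1≡239^v) = [m+n]%d≡n%d⇒d∣m c 1 (begin
  (c + 1) % 4     ≡⟨ cong (_% 4) c+1≡239^v ⟩
  239 ^ v % 4     ≡⟨ 239^v%3≡1⇒239^v%4≡1 v (trans (cong (_% 3) (sym c+1≡239^v)) (%-remove-+ˡ 1 3∣c)) ⟩
  1               ∎)

3∣c∧c+1≡239^v⇒239²-1≤c : ∀ {c} v → 3 ≤ c → 3 ∣ c → c + 1 ≡ 239 ^ v → 239 ^ 2 ∸ 1 ≤ c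
3∣c∧c+1≡239^v⇒239²-1≤c {c} zero 3≤c _ c+1≡1 with +-cancelʳ-≡ 1 c 0 c+1≡1
... | refl = contradiction 3≤c λ ()
3∣c∧c+1≡239^v⇒239²-1≤c {c} (suc zero) _ 3∣c c+1≡239 with +-cancelʳ-≡ 1 c 238 c+1≡239
... | refl = contradiction 3∣c (from-no (3 ∣? 238))
3∣c∧c+1≡239^v⇒239²-1≤c {c} (suc (suc w)) _ _ c+1≡239^v =
  +-cancelʳ-≤ 1 _ c (subst (239 ^ 2 ≤_) (sym c+1≡239^v) (^-monoʳ-≤ 239 {2} {2 + w} (s≤s (s≤s z≤n))))

13⁵∣c+2∧c+1≡239^v⇒23167∣c : ∀ {c} v → 13 ^ 5 ∣ c + 2 → c + 1 ≡ 239 ^ v → 23167 ∣ c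
13⁵∣c+2∧c+1≡239^v⇒23167∣c {c} v 13⁵∣c+2 c+1≡239^v = [m+n]%d≡n%d⇒d∣m c 1 (begin
  (c + 1) % 23167 ≡⟨ cong (_% 23167) c+1≡239^v ⟩
  239 ^ v % 23167 ≡⟨ 239^v%13⁵≡-1⇒239^v%23167≡1 v (trans (cong (_% 13 ^ 5) (sym c+1≡239^v)) c+1%13⁵≡-1) ⟩
  1               ∎)
  where
  c+1%13⁵≡-1 : (c + 1) % 13 ^ 5 ≡ 13 ^ 5 ∸ 1
  c+1%13⁵≡-1 = %-pred-≡0 {c + 1} (trans (cong (_% 13 ^ 5) (sym (+-suc c 1))) (n∣m⇒m%n≡0 (c + 2) (13 ^ 5) 13⁵∣c+2))

c≡239²-1⊎23167∣c : ∀ {c} → 3 ≤ c → 3 ∣ c → ∃[ v ] c + 1 ≡ 239 ^ v → ∃[ t ] c + 2 ≡ 2 * 13 ^ t →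
                   c ≡ 239 ^ 2 ∸ 1 ⊎ 23167 ∣ c
c≡239²-1⊎23167∣c {c} 3≤c 3∣c (v , c+1≡239^v) (t , c+2≡2*13^t) with t ≤? 4
... | yes t≤4 = inj₁ (≤-antisym c≤239²-1 (3∣c∧c+1≡239^v⇒239²-1≤c v 3≤c 3∣c c+1≡239^v))
  where
  c≤239²-1 : c ≤ 239 ^ 2 ∸ 1
  c≤239²-1 = +-cancelʳ-≤ 2 c _ (subst (_≤ 2 * 13 ^ 4) (sym c+2≡2*13^t) (*-monoʳ-≤ 2 (^-monoʳ-≤ 13 t≤4)))
... | no  t≰4 = inj₂ (13⁵∣c+2∧c+1≡239^v⇒23167∣c v 13⁵∣c+2 c+1≡239^v)
  where
  13⁵∣c+2 : 13 ^ 5 ∣ c + 2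
  13⁵∣c+2 = subst (13 ^ 5 ∣_) (sym c+2≡2*13^t) (∣-trans (^-monoʳ-∣ 13 (≰⇒> t≰4)) (n∣m*n 2))

23167∤c : ∀ {c} → MultDep (2 ∷ (239 ^ 2 ∸ 1) ∷ c ∷ []) → 23167 ∤ c
23167∤c dep 23167∣c =
  [ from-no (23167 ∣? 2) , from-no (23167 ∣? (239 ^ 2 ∸ 1)) ]
  (prime∣z⇒∣A⊎∣B prime[2] ∣-refl 3-prime (from-yes (3 ∣? (239 ^ 2 ∸ 1))) (from-no (3 ∣? 2)) dep 23167-prime 23167∣c)

3∤c⇒4∣c : ∀ {c} → 3 ≤ c → MultDep (2 ∷ (239 ^ 2 ∸ 1) ∷ c ∷ []) → 3 ∤ c → 4 ∣ c
3∤c⇒4∣c {c} 3≤c dep 3∤c = c≡2^x⇒4∣c (prime-factors⇒≡^ c {{≢-nonZero (m<n⇒n≢0 3≤c)}} prime∣c⇒≡2)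
  where
  prime∣c⇒≡2 : ∀ {p} → Prime p → p ∣ c → p ≡ 2
  prime∣c⇒≡2 p-prime p∣c = prime∣prime⇒≡ p-prime prime[2]
    (s∤z⇒prime∣z⇒∣A prime[2] ∣-refl 3-prime (from-yes (3 ∣? (239 ^ 2 ∸ 1))) (from-no (3 ∣? 2)) dep 3∤c p-prime p∣c)
  c≡2^x⇒4∣c : ∃[ x ] c ≡ 2 ^ x → 4 ∣ c
  c≡2^x⇒4∣c (x , c≡2^x) = subst (4 ∣_) (sym c≡2^x) (3≤2^n⇒4∣2^n x (subst (3 ≤_) c≡2^x 3≤c))

3∣c⇒c+1≡239^v : ∀ {c} → MultDep (3 ∷ 239 ^ 2 ∷ (c + 1) ∷ []) → 3 ∣ c → ∃[ v ] c + 1 ≡ 239 ^ v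
3∣c⇒c+1≡239^v {c} dep 3∣c = prime-factors⇒≡^ (c + 1) {{≢-nonZero (m+1+n≢0 c)}} prime∣c+1⇒≡239
  where
  3∤c+1 : 3 ∤ c + 1
  3∤c+1 3∣c+1 = from-no (3 ∣? 1) (∣m+n∣m⇒∣n 3∣c+1 3∣c)
  prime∣c+1⇒≡239 : ∀ {p} → Prime p → p ∣ c + 1 → p ≡ 239
  prime∣c+1⇒≡239 p-prime p∣c+1 =
    [ (λ p∣3 → contradiction (subst (_∣ c + 1) (prime∣prime⇒≡ p-prime 3-prime p∣3) p∣c+1) 3∤c+1)
    , prime∣prime^⇒≡ 2 p-prime 239-prime ]
    (prime∣z⇒∣A⊎∣B 3-prime ∣-refl 239-prime (from-yes (239 ∣? 239 ^ 2)) (from-no (239 ∣? 3)) dep p-prime p∣c+1)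

c+2-smooth : ∀ {c} → MultDep (4 ∷ (239 ^ 2 + 1) ∷ (c + 2) ∷ []) → ∃[ s ] ∃[ t ] c + 2 ≡ 2 ^ s * 13 ^ t
c+2-smooth {c} dep = prime-factors⇒≡^*^ (c + 2) {{≢-nonZero (m+1+n≢0 c)}} prime∣c+2⇒≡2⊎≡13
  where
  prime∣c+2⇒≡2⊎≡13 : ∀ {p} → Prime p → p ∣ c + 2 → p ≡ 2 ⊎ p ≡ 13
  prime∣c+2⇒≡2⊎≡13 p-prime p∣c+2 =
    [ inj₁ ∘ prime∣prime^⇒≡ 2 p-prime prime[2]
    , Sum.map (prime∣prime⇒≡ p-prime prime[2]) (prime∣prime^⇒≡ 4 p-prime 13-prime) ∘ euclidsLemma 2 (13 ^ 4) p-prime ]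
    (prime∣z⇒∣A⊎∣B prime[2] (from-yes (2 ∣? 4)) 13-prime (from-yes (13 ∣? (239 ^ 2 + 1))) (from-no (13 ∣? 4)) dep p-prime p∣c+2)

lemma7 : (c : ℕ) → 3 ≤ c → ¬ (c ≡ 239 ^ 2 ∸ 1) →
    ¬ (MultDep (2 ∷ (239 ^ 2 ∸ 1) ∷ c ∷ [])
       × MultDep (3 ∷ 239 ^ 2 ∷ (c + 1) ∷ [])
       × MultDep (4 ∷ (239 ^ 2 + 1) ∷ (c + 2) ∷ []))
lemma7 c 3≤c c≢239²-1 (dep₁ , dep₂ , dep₃) =
  [ c≢239²-1 , 23167∤c dep₁ ]
  (c≡239²-1⊎23167∣c 3≤c 3∣c c+1≡239^v (c+2≡2*13^t (3∣c∧c+1≡239^v⇒4∣c 3∣c c+1≡239^v)))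
  where
  c+2≡2*13^t : 4 ∣ c → ∃[ t ] c + 2 ≡ 2 * 13 ^ t
  c+2≡2*13^t 4∣c = 4∣c∧c+2-smooth⇒c+2≡2*13^t 4∣c (c+2-smooth dep₃)

  3∣c : 3 ∣ c
  3∣c = decidable-stable (3 ∣? c) λ 3∤c → 3∤c (c+2≡2*13^t⇒3∣c (c+2≡2*13^t (3∤c⇒4∣c 3≤c dep₁ 3∤c)))

  c+1≡239^v : ∃[ v ] c + 1 ≡ 239 ^ v
  c+1≡239^v = 3∣c⇒c+1≡239^v dep₂ 3∣c
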